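{- Let $P$ be a finite poset. (1) If $\Phi:P\to\overline{\mathbb{P}}$ is a labeled flag, then there exist a bijection $\omega:P\to\{1,\dots,\#P\}$ and a map $\rho:P\to\mathbb{Z}_{>0}$ satisfying condition (LF) such that $\mathrm{Part}(P,\Phi)=\mathrm{Part}(P,\omega,\rho)$. (2) Conversely, for any bijection $\omega:P\to\{1,\dots,\#P\}$ and map $\rho:P\to\mathbb{Z}_{>0}$ satisfying (LF), there exists a labeled flag $\Phi$ on $P$ such that $\mathrm{Part}(P,\Phi)=\mathrm{Part}(P,\omega,\rho)$.
   Context: $\overline{\mathbb{P}}$ is the totally ordered alphabet of symbols $i_j$ with $i,j\in\mathbb{Z}_{>0}$, ordered lexicographically, with $\mathrm{val}(i_j)=i$. A labeled flag on $P$ is an injective map $\Phi:P\to\overline{\mathbb{P}}$. Write $u\prec_P v$ when $v$ covers $u$. A $(P,\Phi)$-partition is a function $f:P\to\mathbb{Z}_{>0}$ with $f(u)\ge f(v)$ if $u\prec_P v$; $f(u)>f(v)$ if $u\prec_P v$ and $\Phi(u)>\Phi(v)$; and $f(u)\le\mathrm{val}(\Phi(u))$ for all $u$. $\mathrm{Part}(P,\Phi)$ is the set of these. Given a bijection $\omega:P\to\{1,\dots,\#P\}$ and $\rho:P\to\mathbb{Z}_{>0}$, a $(P,\omega,\rho)$-partition is a function $f:P\to\mathbb{Z}_{>0}$ with $f(u)\ge f(v)$ if $u\prec_P v$; $f(u)>f(v)$ if $u\prec_P v$ and $\omega(u)>\omega(v)$; and $f(u)\le\rho(u)$ for all $u$;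 $\mathrm{Part}(P,\omega,\rho)$ is the set of these. Condition (LF): for all $u,v\in P$, $\rho(u)>\rho(v)$ implies $\omega(u)>\omega(v)$. -}

module Defs where

open import Level using (0ℓ)
open import Data.Nat using (ℕ; zero; suc; _≤_; _<_; _>_)
open import Data.Fin using (Fin; toℕ)
open import Data.Product using (_×_; Σ; ∃; _,_)
open import Data.Sum using (_⊎_)
open import Relation.Nullary using (¬_)
open import Relation.Binary.PropositionalEquality using (_≡_)
open import Relation.Binary.Structures using (IsPartialOrder)
open import Function.Bundles using (_⤖_; Bijection)
open import Function using (_∘_)

record FinPoset (n : ℕ) : Set₁ where
  field
    _≤P_ : Fin n → Fin n → Set
    isPartialOrder : IsPartialOrder _≡_ _≤P_

  _<P_ : Fin n → Fin n → Set
  u <P v = (u ≤P v) × ¬ (u ≡ v)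

  _≺P_ : Fin n → Fin n → Set
  u ≺P v = (u <P v) × (∀ w → ¬ ((u <P w) × (w <P v)))

open FinPoset public

-- The alphabet P̄ : symbols i_j with i , j ≥ 1, encoded as pairs (i , j).
record Sym : Set where
  constructor _⟨_⟩
  field
    idx : ℕ
    sub : ℕ

val : Sym → ℕ
val (i ⟨ j ⟩) = i

ValidSym : Sym → Set
ValidSym (i ⟨ j ⟩) = (0 < i) × (0 < j)

_<Sym_ : Sym → Sym → Set
(i ⟨ j ⟩) <Sym (k ⟨ l ⟩) = (i < k) ⊎ ((i ≡ k) × (j < l))

record LabeledFlag {n : ℕ} (P : FinPoset n) : Set where
  field
    Φ : Fin n → Sym
    valid : ∀ u → ValidSym (Φ u)
    injective : ∀ u v → Φ u ≡ Φ v → u ≡ v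

open LabeledFlag public

IsPartΦ : ∀ {n} (P : FinPoset n) → (Fin n → Sym) → (Fin n → ℕ) → Set
IsPartΦ P Φ f =
    (∀ u → 0 < f u)
  × (∀ u v → _≺P_ P u v → f v ≤ f u)
  × (∀ u v → _≺P_ P u v → Φ v <Sym Φ u → f u > f v)
  × (∀ u → f u ≤ val (Φ u))

-- the bijection ω : P → {1,…,#P} is encoded as a bijection Fin n ⤖ Fin n,
-- with ω(u) = 1 + toℕ (ω u).
ωval : ∀ {n} → (Fin n ⤖ Fin n) → Fin n → ℕ
ωval ω u = suc (toℕ (Bijection.to ω u))

IsPartωρ : ∀ {n} (P : FinPoset n) → (Fin n ⤖ Fin n) → (Fin n → ℕ) → (Fin n → ℕ) → Set
IsPartωρ P ω ρ f =
    (∀ u → 0 < f u)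
  × (∀ u v → _≺P_ P u v → f v ≤ f u)
  × (∀ u v → _≺P_ P u v → ωval ω u > ωval ω v → f u > f v)
  × (∀ u → f u ≤ ρ u)

PosMap : ∀ {n} → (Fin n → ℕ) → Set
PosMap ρ = ∀ u → 0 < ρ u

LF : ∀ {n} → (Fin n ⤖ Fin n) → (Fin n → ℕ) → Set
LF ω ρ = ∀ u v → ρ u > ρ v → ωval ω u > ωval ω v

SamePart : ∀ {n} → ((Fin n → ℕ) → Set) → ((Fin n → ℕ) → Set) → Set
SamePart {n} A B = ∀ (f : Fin n → ℕ) → (A f → B f) × (B f → A f)

module Submission where

-- The conditions defining a (P,Φ)-partition see Φ only through val ∘ Φ and through the
-- relative order of the labels, so both directions amount to matching that order with ω:
-- if Φ u < Φ v implies ω u < ω v, the converse follows because both orders are total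
-- and Φ is injective, and then Part(P,Φ) = Part(P,ω,val ∘ Φ). Given Φ, let ω rank the
-- labels, ω u = 1 + #{w | Φ w < Φ u}; given (ω, ρ), take Φ u = ρ(u)_{ω(u)}, which is
-- compatible with ω precisely by (LF).

open import Defs
open import Level using (0ℓ)
open import Data.Bool.Properties using (T-≡)
open import Data.Nat as ℕ using (ℕ; suc; s≤s; z≤n)
open import Data.Nat.Properties using (<-cmp; <-trans; suc-injective; <-irrefl; <-asym; 1+n≰n)
open import Data.Fin as Fin using (Fin; toℕ; fromℕ<; punchOut)
open import Data.Fin.Properties using (any?; _≟_; injective⇒≤; punchOut-injective; toℕ-fromℕ<; toℕ-injective) renaming (<-asym to Fin-<-asym)
open import Data.Fin.Subset using (Subset; _∈_; _⊂_; ⊤; ∣_∣)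
open import Data.Fin.Subset.Properties using (p⊂q⇒∣p∣<∣q∣; ∈⊤; ∣⊤∣≡n)
open import Data.Vec using (tabulate)
open import Data.Vec.Properties using (lookup∘tabulate; []=⇒lookup; lookup⇒[]=)
open import Data.Product using (Σ; _×_; _,_; proj₁; proj₂)
open import Data.Sum using (inj₁; inj₂; [_,_])
open import Function using (_∘_)
open import Function.Bundles using (_⤖_; mk⤖; Bijection; Equivalence)
open import Function.Definitions using (Injective; Surjective)
open import Relation.Nullary using (¬_; yes; no; contradiction)
open import Relation.Nullary.Decidable using (isYes; toWitness; fromWitness)
open import Relation.Unary using (Pred; Decidable)
open import Relation.Binary using (Rel; Transitive; Asymmetric; Trichotomous; IsStrictTotalOrder; tri<; tri≈; tri>)
open import Relation.Binary.Structures.Biased using (isStrictTotalOrderᶜ)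
open import Relation.Binary.PropositionalEquality using (_≡_; refl; sym; trans; subst; subst₂; cong; isEquivalence)

<Sym-trans : Transitive _<Sym_
<Sym-trans (inj₁ i<k)         (inj₁ k<m)         = inj₁ (<-trans i<k k<m)
<Sym-trans (inj₁ i<k)         (inj₂ (refl , _))  = inj₁ i<k
<Sym-trans (inj₂ (refl , _))  (inj₁ k<m)         = inj₁ k<m
<Sym-trans (inj₂ (refl , j<l)) (inj₂ (refl , l<o)) = inj₂ (refl , <-trans j<l l<o)

≮sub⇒≮Sym : ∀ {i j l} → ¬ j ℕ.< l → ¬ ((i ⟨ j ⟩) <Sym (i ⟨ l ⟩))
≮sub⇒≮Sym j≮l = [ <-irrefl refl , j≮l ∘ proj₂ ]

<Sym-compare : Trichotomous _≡_ _<Sym_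
<Sym-compare (i ⟨ j ⟩) (k ⟨ l ⟩) with <-cmp i k
... | tri< i<k i≢k k≮i = tri< (inj₁ i<k) (i≢k ∘ cong Sym.idx)
                              [ k≮i , (λ (k≡i , _) → i≢k (sym k≡i)) ]
... | tri> i≮k i≢k k<i = tri> [ i≮k , (λ (i≡k , _) → i≢k i≡k) ]
                              (i≢k ∘ cong Sym.idx) (inj₁ k<i)
... | tri≈ _ refl _ with <-cmp j l
...   | tri< j<l j≢l l≮j = tri< (inj₂ (refl , j<l)) (j≢l ∘ cong Sym.sub) (≮sub⇒≮Sym l≮j)
...   | tri≈ j≮j refl _  = tri≈ (≮sub⇒≮Sym j≮j) refl (≮sub⇒≮Sym j≮j)
...   | tri> j≮l j≢l l<j = tri> (≮sub⇒≮Sym j≮l) (j≢l ∘ cong Sym.sub) (inj₂ (refl , l<j))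

val<⇒<Sym : ∀ a b → val a ℕ.< val b → a <Sym b
val<⇒<Sym (_ ⟨ _ ⟩) (_ ⟨ _ ⟩) = inj₁

<Sym-isStrictTotalOrder : IsStrictTotalOrder _≡_ _<Sym_
<Sym-isStrictTotalOrder = isStrictTotalOrderᶜ record
  { isEquivalence = isEquivalence ; trans = <Sym-trans ; compare = <Sym-compare }

-- Punching a missed value out of a non-surjective injection would inject Fin (1 + n) into Fin n.
injective⇒surjective : ∀ {n} {f : Fin n → Fin n} →
                       Injective _≡_ _≡_ f → Surjective _≡_ _≡_ f
injective⇒surjective {suc n} {f} f-inj y with any? (λ x → f x ≟ y)
... | yes (x , fx≡y) = x , λ { refl → fx≡y }
... | no ∄x = contradiction (injective⇒≤ punchOut-f-injective) 1+n≰n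
  where
  missed : ∀ x → ¬ (y ≡ f x)
  missed x y≡fx = ∄x (x , sym y≡fx)
  punchOut-f-injective : Injective _≡_ _≡_ (λ x → punchOut (missed x))
  punchOut-f-injective {x} {x′} = f-inj ∘ punchOut-injective (missed x) (missed x′)

subsetOf : ∀ {n ℓ} {P : Pred (Fin n) ℓ} → Decidable P → Subset n
subsetOf P? = tabulate (isYes ∘ P?)

module _ {n ℓ} {P : Pred (Fin n) ℓ} (P? : Decidable P) {x : Fin n} where

  ∈-subsetOf⁺ : P x → x ∈ subsetOf P?
  ∈-subsetOf⁺ px =
    lookup⇒[]= x _ (trans (lookup∘tabulate _ x) (Equivalence.to T-≡ (fromWitness px)))

  ∈-subsetOf⁻ : x ∈ subsetOf P? → P x
  ∈-subsetOf⁻ x∈ =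
    toWitness (Equivalence.from T-≡ (trans (sym (lookup∘tabulate _ x)) ([]=⇒lookup x∈)))

module StrictlyMonotone
  {A B X : Set} {_<A_ : Rel A 0ℓ} {_<B_ : Rel B 0ℓ}
  (compare : Trichotomous _≡_ _<A_) (asym : Asymmetric _<B_)
  (f : X → A) (f-injective : Injective _≡_ _≡_ f)
  (g : X → B) (mono : ∀ {x y} → f x <A f y → g x <B g y)
  where

  private
    irrefl : ∀ {b} → ¬ b <B b
    irrefl b<b = asym b<b b<b

  reflects : ∀ {x y} → g x <B g y → f x <A f y
  reflects {x} {y} gx<gy with compare (f x) (f y)
  ... | tri< fx<fy _ _ = fx<fy
  ... | tri≈ _ fx≡fy _ with refl ← f-injective fx≡fy = contradiction gx<gy irrefl
  ... | tri> _ _ fy<fx = contradiction (mono fy<fx) (asym gx<gy)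

  g-injective : Injective _≡_ _≡_ g
  g-injective {x} {y} gx≡gy with compare (f x) (f y)
  ... | tri< fx<fy _ _ = contradiction (subst (_<B g y) gx≡gy (mono fx<fy)) irrefl
  ... | tri≈ _ fx≡fy _ = f-injective fx≡fy
  ... | tri> _ _ fy<fx = contradiction (subst (g y <B_) gx≡gy (mono fy<fx)) irrefl

module Ranking
  {A : Set} {_<_ : Rel A 0ℓ} (sto : IsStrictTotalOrder _≡_ _<_) {n} (Ψ : Fin n → A)
  where

  private module S = IsStrictTotalOrder sto

  below : Fin n → Subset n
  below u = subsetOf (λ w → Ψ w S.<? Ψ u)

  below-⊂ : ∀ {u v} → Ψ u < Ψ v → below u ⊂ below v
  below-⊂ {u} {v} Ψu<Ψv =
      (λ w∈ → ∈-subsetOf⁺ _ (S.trans (∈-subsetOf⁻ _ w∈) Ψu<Ψv))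
    , u , ∈-subsetOf⁺ _ Ψu<Ψv , S.irrefl refl ∘ ∈-subsetOf⁻ _

  below-⊂⊤ : ∀ u → below u ⊂ ⊤
  below-⊂⊤ u = (λ _ → ∈⊤) , u , ∈⊤ , S.irrefl refl ∘ ∈-subsetOf⁻ _

  ∣below∣<n : ∀ u → ∣ below u ∣ ℕ.< n
  ∣below∣<n u = subst (∣ below u ∣ ℕ.<_) (∣⊤∣≡n n) (p⊂q⇒∣p∣<∣q∣ (below-⊂⊤ u))

  rank : Fin n → Fin n
  rank u = fromℕ< (∣below∣<n u)

  rank-mono : ∀ {u v} → Ψ u < Ψ v → rank u Fin.< rank v
  rank-mono {u} {v} Ψu<Ψv =
    subst₂ ℕ._<_ (sym (toℕ-fromℕ< (∣below∣<n u))) (sym (toℕ-fromℕ< (∣below∣<n v)))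
           (p⊂q⇒∣p∣<∣q∣ (below-⊂ Ψu<Ψv))

  ranking : Injective _≡_ _≡_ Ψ → Fin n ⤖ Fin n
  ranking Ψ-injective = mk⤖ (rank-injective , injective⇒surjective rank-injective)
    where open StrictlyMonotone {_<B_ = Fin._<_} S.compare Fin-<-asym Ψ Ψ-injective rank rank-mono
            renaming (g-injective to rank-injective)

Compatible : ∀ {n} → (Fin n → Sym) → (Fin n ⤖ Fin n) → Set
Compatible Φ ω = ∀ u v → Φ u <Sym Φ v → ωval ω u ℕ.< ωval ω v

compatible⇒samePart : ∀ {n} (P : FinPoset n) (Φ : Fin n → Sym) (ω : Fin n ⤖ Fin n) →
  Injective _≡_ _≡_ Φ → Compatible Φ ω → SamePart (IsPartΦ P Φ) (IsPartωρ P ω (val ∘ Φ))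
compatible⇒samePart P Φ ω Φ-injective compatible f =
    (λ (pos , weak , strict , bounded) →
       pos , weak , (λ u v u≺v → strict u v u≺v ∘ reflects) , bounded)
  , (λ (pos , weak , strict , bounded) →
       pos , weak , (λ u v u≺v → strict u v u≺v ∘ compatible v u) , bounded)
  where open StrictlyMonotone {_<B_ = ℕ._<_} <Sym-compare <-asym
                              Φ Φ-injective (ωval ω) (compatible _ _)

flag⇒ωρ : ∀ {n} (P : FinPoset n) (F : LabeledFlag P) →
  Σ (Fin n ⤖ Fin n) λ ω → Σ (Fin n → ℕ) λ ρ →
    PosMap ρ × LF ω ρ × SamePart (IsPartΦ P (Φ F)) (IsPartωρ P ω ρ)
flag⇒ωρ P F = ω , val ∘ Φ F , val-pos , lf , compatible⇒samePart P (Φ F) ω Φ-injective compatible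
  where
  Φ-injective : Injective _≡_ _≡_ (Φ F)
  Φ-injective = injective F _ _

  open Ranking <Sym-isStrictTotalOrder (Φ F)

  ω : Fin _ ⤖ Fin _
  ω = ranking Φ-injective

  compatible : Compatible (Φ F) ω
  compatible u v = s≤s ∘ rank-mono

  val-pos : PosMap (val ∘ Φ F)
  val-pos u = proj₁ (valid F u)

  lf : LF ω (val ∘ Φ F)
  lf u v = compatible v u ∘ val<⇒<Sym (Φ F v) (Φ F u)

flagOf : ∀ {n} → (Fin n ⤖ Fin n) → (Fin n → ℕ) → Fin n → Sym
flagOf ω ρ u = ρ u ⟨ ωval ω u ⟩

flagOf-injective : ∀ {n} (ω : Fin n ⤖ Fin n) (ρ : Fin n → ℕ) → Injective _≡_ _≡_ (flagOf ω ρ)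
flagOf-injective ω ρ = Bijection.injective ω ∘ toℕ-injective ∘ suc-injective ∘ cong Sym.sub

flagOf-compatible : ∀ {n} (ω : Fin n ⤖ Fin n) (ρ : Fin n → ℕ) → LF ω ρ → Compatible (flagOf ω ρ) ω
flagOf-compatible ω ρ lf u v (inj₁ ρu<ρv)       = lf v u ρu<ρv
flagOf-compatible ω ρ lf u v (inj₂ (_ , ωu<ωv)) = ωu<ωv

ωρ⇒flag : ∀ {n} (P : FinPoset n) (ω : Fin n ⤖ Fin n) (ρ : Fin n → ℕ) → PosMap ρ → LF ω ρ →
  Σ (LabeledFlag P) λ F → SamePart (IsPartΦ P (Φ F)) (IsPartωρ P ω ρ)
ωρ⇒flag P ω ρ ρ-pos lf =
  F , compatible⇒samePart P (flagOf ω ρ) ω (flagOf-injective ω ρ) (flagOf-compatible ω ρ lf)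
  where
  F : LabeledFlag P
  F = record
    { Φ = flagOf ω ρ ; valid = λ u → ρ-pos u , s≤s z≤n ; injective = λ _ _ → flagOf-injective ω ρ }

proposition3p3 : ∀ {n : ℕ} (P : FinPoset n) →
    ((F : LabeledFlag P) →
      Σ (Fin n ⤖ Fin n) λ ω → Σ (Fin n → ℕ) λ ρ →
        PosMap ρ × LF ω ρ × SamePart (IsPartΦ P (Φ F)) (IsPartωρ P ω ρ))
    × ((ω : Fin n ⤖ Fin n) (ρ : Fin n → ℕ) → PosMap ρ → LF ω ρ →
      Σ (LabeledFlag P) λ F → SamePart (IsPartΦ P (Φ F)) (IsPartωρ P ω ρ))
proposition3p3 P = flag⇒ωρ P , ωρ⇒flag P
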